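{- Let $\mathcal{S}$ be a string of length $n$. For every $i\in[1,n]$, $\mathrm{pss}[i]=\max\{j : j\in\mathcal{P}_{i-1}\text{ and }\mathcal{S}_j\prec\mathcal{S}_i\}$.
   Context: $\mathcal{S}_k=\mathcal{S}[k..n]$; suffixes compared lexicographically (a proper prefix is smaller); $\mathcal{S}_0$ is an artificial suffix (sentinel) smaller than every $\mathcal{S}_k$, $k\in[1,n]$. $\mathrm{pss}[i]=\max\{j\in[0,i):\mathcal{S}_j\prec\mathcal{S}_i\}$ for $i\in[1,n]$. The PSS closure is defined recursively by $\mathcal{P}_0=\{0\}$ and $\mathcal{P}_j=\{j\}\cup\mathcal{P}_{\mathrm{pss}[j]}$ for $j\in[1,n]$. -}

module Defs where

open import Level using (Level)
open import Data.Nat using (ℕ; zero; suc; _≤_; _<_; _∸_)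
open import Data.List using (List; drop; length)
open import Data.Empty using (⊥)
open import Data.Unit using (⊤)
open import Data.Product using (_×_)
open import Relation.Nullary using (¬_)
open import Relation.Binary.Bundles using (StrictTotalOrder)
open import Data.List.Relation.Binary.Lex.Strict using (Lex-<)

module Suffixes {a ℓ₁ ℓ₂ : Level} (Σ : StrictTotalOrder a ℓ₁ ℓ₂) where
  open StrictTotalOrder Σ renaming (Carrier to Char; _<_ to _<ᶜ_)

  -- Strict lexicographic order on strings (a proper prefix is smaller).
  _≺ˢ_ : List Char → List Char → Set _
  _≺ˢ_ = Lex-< _≈_ _<ᶜ_

  -- Suffix S_k = S[k..n] (1-based), i.e. drop (k-1) S, for k ≥ 1.
  suf : List Char → ℕ → List Char
  suf S k = drop (k ∸ 1) S

  -- Comparison of suffixes by starting index; index 0 is the sentinel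
  -- suffix S_0, smaller than every S_k with k ≥ 1.
  SufLt : List Char → ℕ → ℕ → Set _
  SufLt S i       zero    = Level.Lift _ ⊥
  SufLt S zero    (suc j) = Level.Lift _ ⊤
  SufLt S (suc i) (suc j) = suf S (suc i) ≺ˢ suf S (suc j)

  IsPSS : List Char → ℕ → ℕ → Set _
  IsPSS S i j = (j < i) × SufLt S j i × (∀ k → k < i → SufLt S k i → k ≤ j)

  -- PSS closure: InP S j x  means  x ∈ P_j, where P_0 = {0} and
  -- P_j = {j} ∪ P_{pss[j]} for j ∈ [1,n].
  data InP (S : List Char) : ℕ → ℕ → Set (a Level.⊔ ℓ₁ Level.⊔ ℓ₂) where
    self : ∀ {j} → InP S j j
    step : ∀ {j p x} → 1 ≤ j → j ≤ length S → IsPSS S j p → InP S p x → InP S j x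

-- The closure P_{i-1} is the chain i-1, pss[i-1], pss[pss[i-1]], … descending to 0, and
-- pss[i] lies on it: if c is a chain element with pss[i] < c < i, then pss[c] ≥ pss[i],
-- for otherwise S_c ≺ S_pss[i] (c's own pss skips pss[i]) and S_i ≺ S_c (pss[i] skips c),
-- giving the cycle S_i ≺ S_c ≺ S_pss[i] ≺ S_i. So walking down the chain from i-1 never
-- jumps over pss[i], and every chain element below i is bounded by pss[i] by maximality.
module Submission where

open import Defs
open import Level using (Level)
open import Data.Nat using (ℕ; zero; suc; _≤_; _<_; _∸_; z≤n; s≤s)
open import Data.Nat.Properties
  using (≤-refl; ≤-trans; <-trans; <⇒≤; <⇒≱; <-irrefl; ≤-pred; m≤n⇒m≤1+n; m≤n⇒m<n∨m≡n; ∸-cancelˡ-≡)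
open import Data.Nat.Induction using (<-wellFounded)
open import Induction.WellFounded using (Acc; acc)
open import Data.List using (List; length)
open import Data.List.Properties using (length-drop)
open import Data.List.Relation.Binary.Pointwise.Properties using (Pointwise-length)
open import Data.List.Relation.Binary.Lex.Strict using (<-strictTotalOrder)
open import Data.Product using (_×_; _,_; ∃-syntax)
open import Data.Sum using (inj₁; inj₂)
open import Function.Bundles using (_⇔_; mk⇔)
open import Relation.Binary.Bundles using (StrictTotalOrder)
open import Relation.Binary.Definitions using (tri<; tri≈; tri>)
open import Relation.Binary.PropositionalEquality using (_≡_; _≢_; refl; sym; trans; cong)
open import Relation.Nullary using (Dec; yes; no; ¬_; contradiction)
open import Relation.Unary using (Decidable)

greatest-witness : ∀ {ℓ} {P : ℕ → Set ℓ} → Decidable P → P 0 → ∀ m →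
                   ∃[ j ] (j ≤ m × P j × (∀ k → k ≤ m → P k → k ≤ j))
greatest-witness P? p0 zero = zero , z≤n , p0 , λ { .zero z≤n _ → z≤n }
greatest-witness {P = P} P? p0 (suc m) with P? (suc m)
... | yes pm = suc m , ≤-refl , pm , λ _ k≤m _ → k≤m
... | no ¬pm with greatest-witness P? p0 m
...   | j , j≤m , pj , greatest = j , m≤n⇒m≤1+n j≤m , pj , below
  where
  below : ∀ k → k ≤ suc m → P k → k ≤ j
  below k k≤ pk with m≤n⇒m<n∨m≡n k≤
  ... | inj₁ k<1+m = greatest k (≤-pred k<1+m) pk
  ... | inj₂ refl  = contradiction pk ¬pm

module PSS {a ℓ₁ ℓ₂ : Level} (Σ : StrictTotalOrder a ℓ₁ ℓ₂)
           (S : List (StrictTotalOrder.Carrier Σ)) where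
  open Suffixes Σ
  private module Lex = StrictTotalOrder (<-strictTotalOrder Σ)

  SufLt-irrefl : ∀ k → ¬ SufLt S k k
  SufLt-irrefl zero    ()
  SufLt-irrefl (suc k) = Lex.irrefl Lex.Eq.refl

  SufLt-trans : ∀ {k l m} → SufLt S k l → SufLt S l m → SufLt S k m
  SufLt-trans {l = zero}  ()
  SufLt-trans {m = zero}  _ ()
  SufLt-trans {zero}  {suc l} {suc m} _ _ = _
  SufLt-trans {suc k} {suc l} {suc m} = Lex.trans

  SufLt? : ∀ k l → Dec (SufLt S k l)
  SufLt? k       zero    = no λ ()
  SufLt? zero    (suc l) = yes _
  SufLt? (suc k) (suc l) = suf S (suc k) Lex.<? suf S (suc l)

  suf-injective : ∀ {c d} → c ≤ length S → d ≤ length S →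
                  suf S (suc c) Lex.≈ suf S (suc d) → c ≡ d
  suf-injective {c} {d} c≤n d≤n eq = ∸-cancelˡ-≡ c≤n d≤n
    (trans (sym (length-drop c S)) (trans (Pointwise-length eq) (length-drop d S)))

  SufLt-connex : ∀ {k l} → k ≤ length S → l ≤ length S → k ≢ l →
                 ¬ SufLt S k l → SufLt S l k
  SufLt-connex {zero}  {zero}  _ _ k≢l _ = contradiction refl k≢l
  SufLt-connex {zero}  {suc l} _ _ _ k≮l = contradiction _ k≮l
  SufLt-connex {suc k} {zero}  _ _ _ _   = _
  SufLt-connex {suc k} {suc l} k<n l<n k≢l k≮l
    with Lex.compare (suf S (suc k)) (suf S (suc l))
  ... | tri< k<l _ _ = contradiction k<l k≮l
  ... | tri≈ _ k≈l _ = contradiction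
                         (cong suc (suf-injective (<⇒≤ k<n) (<⇒≤ l<n) k≈l))
                         k≢l
  ... | tri> _ _ l<k = l<k

  pss : ∀ i → ∃[ p ] IsPSS S (suc i) p
  pss i with greatest-witness (λ k → SufLt? k (suc i)) _ i
  ... | p , p≤i , p≺i , greatest = p , s≤s p≤i , p≺i , λ k k<1+i → greatest k (≤-pred k<1+i)

  InP⇒≤ : ∀ {c x} → InP S c x → x ≤ c
  InP⇒≤ self                    = ≤-refl
  InP⇒≤ (step _ _ (p<c , _) x∈P) = ≤-trans (InP⇒≤ x∈P) (<⇒≤ p<c)

  pss-between : ∀ {i j c p} → i ≤ length S → IsPSS S i j → IsPSS S c p →
                j < c → c < i → j ≤ p
  pss-between {i} {j} {c} i≤n (_ , j≺i , maximalᵢ) (_ , _ , maximal꜀) j<c c<i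
    with SufLt? j c
  ... | yes j≺c = maximal꜀ j j<c j≺c
  ... | no  j⊀c = contradiction (SufLt-trans i≺c (SufLt-trans c≺j j≺i)) (SufLt-irrefl i)
    where
    c≤n = ≤-trans (<⇒≤ c<i) i≤n
    c⊀i : ¬ SufLt S c i
    c⊀i c≺i = <⇒≱ j<c (maximalᵢ c c<i c≺i)
    c≺j : SufLt S c j
    c≺j = SufLt-connex (≤-trans (<⇒≤ j<c) c≤n) c≤n (λ { refl → <-irrefl refl j<c }) j⊀c
    i≺c : SufLt S i c
    i≺c = SufLt-connex c≤n i≤n (λ { refl → <-irrefl refl c<i }) c⊀i

  pss-in-chain : ∀ {i j} → i ≤ length S → IsPSS S i j →
                 ∀ {c} → Acc _<_ c → j ≤ c → c < i → InP S c j
  pss-in-chain i≤n pssᵢ {zero}  _        z≤n _ = self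
  pss-in-chain i≤n pssᵢ {suc c} (acc rs) j≤c c<i with m≤n⇒m<n∨m≡n j≤c
  ... | inj₂ refl = self
  ... | inj₁ j<c with pss c
  ...   | p , pss꜀@(p<c , _) =
    step (s≤s z≤n) (≤-trans (<⇒≤ c<i) i≤n) pss꜀
      (pss-in-chain i≤n pssᵢ (rs p<c) (pss-between i≤n pssᵢ pss꜀ j<c c<i) (<-trans p<c c<i))

  pss-in-closure : ∀ {i j} → suc i ≤ length S → IsPSS S (suc i) j → InP S i j
  pss-in-closure i≤n pssᵢ@(j<i , _) = pss-in-chain i≤n pssᵢ (<-wellFounded _) (≤-pred j<i) ≤-refl

mainTheorem5 : ∀ {a ℓ₁ ℓ₂ : Level} (Σ : StrictTotalOrder a ℓ₁ ℓ₂) →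
    let open Suffixes Σ in
    (S : List (StrictTotalOrder.Carrier Σ)) (i : ℕ) → 1 ≤ i → i ≤ length S → (j : ℕ) →
    IsPSS S i j ⇔ (InP S (i ∸ 1) j × SufLt S j i × (∀ k → InP S (i ∸ 1) k → SufLt S k i → k ≤ j))
mainTheorem5 Σ S (suc i) _ i≤n j = mk⇔ to from
  where
  open Suffixes Σ
  open PSS Σ S
  MaxInClosure : Set _
  MaxInClosure = InP S i j × SufLt S j (suc i) × (∀ k → InP S i k → SufLt S k (suc i) → k ≤ j)

  to : IsPSS S (suc i) j → MaxInClosure
  to pssᵢ@(_ , j≺i , maximal) =
    pss-in-closure i≤n pssᵢ , j≺i , λ k k∈P → maximal k (s≤s (InP⇒≤ k∈P))

  from : MaxInClosure → IsPSS S (suc i) j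
  from (j∈P , j≺i , maximal) with pss i
  ... | p , pssᵢ@(_ , p≺i , maximalₚ) =
    s≤s (InP⇒≤ j∈P) , j≺i ,
    λ k k<i k≺i → ≤-trans (maximalₚ k k<i k≺i) (maximal p (pss-in-closure i≤n pssᵢ) p≺i)
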